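{- For all types $A,B,C_1,C_2$ such that $A\Rightarrow B\equiv C_1\wedge C_2$, there exist types $B_1,B_2$ such that $C_1\equiv A\Rightarrow B_1$, $C_2\equiv A\Rightarrow B_2$ and $B\equiv B_1\wedge B_2$.
   Context: Types: $A ::= X \mid A\Rightarrow A \mid A\wedge A \mid \forall X.A$, $X$ type variables, modulo $\alpha$-equivalence; $\Rightarrow$ associates to the right. Type isomorphism $\equiv$ is the smallest congruence on types containing: $A\wedge B\equiv B\wedge A$; $A\wedge(B\wedge C)\equiv(A\wedge B)\wedge C$; $A\Rightarrow(B\wedge C)\equiv(A\Rightarrow B)\wedge(A\Rightarrow C)$; $(A\wedge B)\Rightarrow C\equiv A\Rightarrow B\Rightarrow C$; $\forall X.(A\Rightarrow B)\equiv A\Rightarrow\forall X.B$ if $X\notin FTV(A)$; $\forall X.(A\wedge B)\equiv\forall X.A\wedge\forall X.B$. -}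

module Defs where

open import Data.Nat using (ℕ; zero; suc)

-- Types with de Bruijn indices (so α-equivalent types are syntactically equal).
-- var n is a type variable (bound by the n-th enclosing ∀, or free otherwise).
infixr 6 _⇒_
infixr 7 _∧_
data Ty : Set where
  var : ℕ → Ty
  _⇒_ : Ty → Ty → Ty
  _∧_ : Ty → Ty → Ty
  all : Ty → Ty

liftVar : ℕ → ℕ → ℕ
liftVar zero    n       = suc n
liftVar (suc c) zero    = zero
liftVar (suc c) (suc n) = suc (liftVar c n)

shiftFrom : ℕ → Ty → Ty
shiftFrom c (var n) = var (liftVar c n)
shiftFrom c (A ⇒ B) = shiftFrom c A ⇒ shiftFrom c B
shiftFrom c (A ∧ B) = shiftFrom c A ∧ shiftFrom c B
shiftFrom c (all A) = all (shiftFrom (suc c) A)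

-- weakening: view a type as living under one more binder; the types of the
-- form (shift A) are exactly those in which the new bound variable does not occur
shift : Ty → Ty
shift = shiftFrom zero

infix 4 _≅_
data _≅_ : Ty → Ty → Set where
  refl  : ∀ {A} → A ≅ A
  sym   : ∀ {A B} → A ≅ B → B ≅ A
  trans : ∀ {A B C} → A ≅ B → B ≅ C → A ≅ C
  cong⇒ : ∀ {A A' B B'} → A ≅ A' → B ≅ B' → (A ⇒ B) ≅ (A' ⇒ B')
  cong∧ : ∀ {A A' B B'} → A ≅ A' → B ≅ B' → (A ∧ B) ≅ (A' ∧ B')
  cong∀ : ∀ {A A'} → A ≅ A' → all A ≅ all A'
  comm  : ∀ {A B} → (A ∧ B) ≅ (B ∧ A)
  asso  : ∀ {A B C} → (A ∧ (B ∧ C)) ≅ ((A ∧ B) ∧ C)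
  dist  : ∀ {A B C} → (A ⇒ (B ∧ C)) ≅ ((A ⇒ B) ∧ (A ⇒ C))
  curry : ∀ {A B C} → ((A ∧ B) ⇒ C) ≅ (A ⇒ B ⇒ C)
  -- ∀X.(A ⇒ B) ≡ A ⇒ ∀X.B with X ∉ FTV(A): under the binder A appears weakened
  p-comm : ∀ {A B} → all (shift A ⇒ B) ≅ (A ⇒ all B)
  p-dist : ∀ {A B} → all (A ∧ B) ≅ (all A ∧ all B)

-- Every type is isomorphic to the conjunction of its list of factors, where the
-- factors of A ⇒ B are the A ⇒ F for the factors F of B, and every axiom of ≅
-- permutes factor lists up to ≅. So the factors of C₁ ∧ C₂, i.e. those of C₁
-- followed by those of C₂, are a permutation of the A ⇒ F for F ranging over the
-- factors of B. Sorting the factors F of B by which side their image lands on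
-- splits them into two nonempty lists; B₁ and B₂ are their conjunctions.
module Submission where

open import Defs
open import Data.List using (List; []; _∷_; _++_; map)
open import Data.List.Properties using (map-++; map-∘)
open import Data.List.Relation.Binary.Pointwise using ([]; _∷_)
import Data.List.Relation.Binary.Permutation.Homogeneous as Perm
open import Data.Product using (Σ; ∃₂; _×_; _,_)
open import Level using (Level; 0ℓ)
open import Relation.Binary.Bundles using (Setoid)

data NonEmpty {a : Level} {A : Set a} : List A → Set a where
  nonEmpty : ∀ {x xs} → NonEmpty (x ∷ xs)

module _ {a b : Level} {A : Set a} {B : Set b} where

  NonEmpty-map⁺ : ∀ {f : A → B} {xs} → NonEmpty xs → NonEmpty (map f xs)
  NonEmpty-map⁺ nonEmpty = nonEmpty

  NonEmpty-map⁻ : ∀ {f : A → B} xs → NonEmpty (map f xs) → NonEmpty xs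
  NonEmpty-map⁻ (_ ∷ _) _ = nonEmpty

NonEmpty-++⁺ˡ : ∀ {a : Level} {A : Set a} {xs ys : List A} → NonEmpty xs → NonEmpty (xs ++ ys)
NonEmpty-++⁺ˡ nonEmpty = nonEmpty

module _ {c ℓ} (S : Setoid c ℓ) where

  open Setoid S using () renaming (Carrier to X; trans to ≈-trans)
  open import Data.List.Relation.Binary.Equality.Setoid S using (_≋_)
  open import Data.List.Relation.Binary.Permutation.Setoid S
    using (_↭_; ↭-refl; ↭-sym; ↭-trans; ↭-prep; ↭-swap)
  open import Data.List.Relation.Binary.Permutation.Setoid.Properties S
    using (↭-shift; xs↭ys⇒|xs|≡|ys|)
  open import Data.List.Relation.Ternary.Interleaving.Setoid S
    using (Interleaving; []; _∷ˡ_; _∷ʳ_)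
  open import Data.List.Relation.Ternary.Interleaving.Setoid.Properties S
    using (++-linear)

  NonEmpty-resp-↭ : ∀ {xs ys} → xs ↭ ys → NonEmpty xs → NonEmpty ys
  NonEmpty-resp-↭ {ys = []} p nonEmpty with () ← xs↭ys⇒|xs|≡|ys| p
  NonEmpty-resp-↭ {ys = _ ∷ _} _ _ = nonEmpty

  interleaving-≋ : ∀ {l r xs ys} → Interleaving l r xs → xs ≋ ys → Interleaving l r ys
  interleaving-≋ []        []       = []
  interleaving-≋ (e ∷ˡ i) (e′ ∷ es) = ≈-trans e e′ ∷ˡ interleaving-≋ i es
  interleaving-≋ (e ∷ʳ i) (e′ ∷ es) = ≈-trans e e′ ∷ʳ interleaving-≋ i es

  interleaving-↭ : ∀ {l r xs ys} → Interleaving l r xs → xs ↭ ys →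
                   ∃₂ λ l′ r′ → Interleaving l′ r′ ys × l ↭ l′ × r ↭ r′
  interleaving-↭ i (Perm.refl es) = _ , _ , interleaving-≋ i es , ↭-refl , ↭-refl
  interleaving-↭ (e ∷ˡ i) (Perm.prep e′ p)
    with l′ , r′ , j , pl , pr ← interleaving-↭ i p =
    _ ∷ l′ , r′ , ≈-trans e e′ ∷ˡ j , ↭-prep _ pl , pr
  interleaving-↭ (e ∷ʳ i) (Perm.prep e′ p)
    with l′ , r′ , j , pl , pr ← interleaving-↭ i p =
    l′ , _ ∷ r′ , ≈-trans e e′ ∷ʳ j , pl , ↭-prep _ pr
  interleaving-↭ (e₁ ∷ˡ e₂ ∷ˡ i) (Perm.swap e₁′ e₂′ p)
    with l′ , r′ , j , pl , pr ← interleaving-↭ i p =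
    _ ∷ _ ∷ l′ , r′ , ≈-trans e₂ e₂′ ∷ˡ ≈-trans e₁ e₁′ ∷ˡ j , ↭-swap _ _ pl , pr
  interleaving-↭ (e₁ ∷ˡ e₂ ∷ʳ i) (Perm.swap e₁′ e₂′ p)
    with l′ , r′ , j , pl , pr ← interleaving-↭ i p =
    _ ∷ l′ , _ ∷ r′ , ≈-trans e₂ e₂′ ∷ʳ ≈-trans e₁ e₁′ ∷ˡ j , ↭-prep _ pl , ↭-prep _ pr
  interleaving-↭ (e₁ ∷ʳ e₂ ∷ˡ i) (Perm.swap e₁′ e₂′ p)
    with l′ , r′ , j , pl , pr ← interleaving-↭ i p =
    _ ∷ l′ , _ ∷ r′ , ≈-trans e₂ e₂′ ∷ˡ ≈-trans e₁ e₁′ ∷ʳ j , ↭-prep _ pl , ↭-prep _ pr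
  interleaving-↭ (e₁ ∷ʳ e₂ ∷ʳ i) (Perm.swap e₁′ e₂′ p)
    with l′ , r′ , j , pl , pr ← interleaving-↭ i p =
    l′ , _ ∷ _ ∷ r′ , ≈-trans e₂ e₂′ ∷ʳ ≈-trans e₁ e₁′ ∷ʳ j , pl , ↭-swap _ _ pr
  interleaving-↭ i (Perm.trans p q)
    with l′ , r′ , j , pl , pr ← interleaving-↭ i p
    with l″ , r″ , k , ql , qr ← interleaving-↭ j q =
    l″ , r″ , k , ↭-trans pl ql , ↭-trans pr qr

  interleaving-map⁻ : ∀ (f : X → X) zs {l r} → Interleaving l r (map f zs) →
                      ∃₂ λ zs₁ zs₂ → zs ↭ zs₁ ++ zs₂ × l ↭ map f zs₁ × r ↭ map f zs₂
  interleaving-map⁻ f [] [] = [] , [] , ↭-refl , ↭-refl , ↭-refl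
  interleaving-map⁻ f (z ∷ zs) (e ∷ˡ i)
    with zs₁ , zs₂ , p , pl , pr ← interleaving-map⁻ f zs i =
    z ∷ zs₁ , zs₂ , ↭-prep z p , Perm.prep e pl , pr
  interleaving-map⁻ f (z ∷ zs) (e ∷ʳ i)
    with zs₁ , zs₂ , p , pl , pr ← interleaving-map⁻ f zs i =
    zs₁ , z ∷ zs₂ , ↭-trans (↭-prep z p) (↭-sym (↭-shift zs₁ zs₂)) , pl , Perm.prep e pr

  map-↭-++⁻ : ∀ (f : X → X) zs {xs ys} → map f zs ↭ xs ++ ys →
              ∃₂ λ zs₁ zs₂ → zs ↭ zs₁ ++ zs₂ × xs ↭ map f zs₁ × ys ↭ map f zs₂
  map-↭-++⁻ f zs {xs} {ys} p
    with l , r , i , xs↭l , ys↭r ← interleaving-↭ (++-linear xs ys) (↭-sym p)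
    with zs₁ , zs₂ , zs↭ , l↭ , r↭ ← interleaving-map⁻ f zs i =
    zs₁ , zs₂ , zs↭ , ↭-trans xs↭l l↭ , ↭-trans ys↭r r↭

≅-setoid : Setoid 0ℓ 0ℓ
≅-setoid = record
  { Carrier       = Ty
  ; _≈_           = _≅_
  ; isEquivalence = record { refl = refl ; sym = sym ; trans = trans }
  }

open import Data.List.Relation.Binary.Equality.Setoid ≅-setoid using (_≋_)
open import Data.List.Relation.Binary.Permutation.Setoid ≅-setoid
  using (_↭_; ↭-refl; ↭-sym; ↭-trans; ↭-reflexive)
open import Data.List.Relation.Binary.Permutation.Setoid.Properties ≅-setoid
  using (map⁺; ++⁺; ++-comm; ++-assoc; xs↭ys⇒|xs|≡|ys|)

-- There is no unit type, so ⋀ [] is the junk value var 0 and the lemmas below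
-- ask for nonempty lists.
⋀ : List Ty → Ty
⋀ []           = var 0
⋀ (x ∷ [])     = x
⋀ (x ∷ y ∷ xs) = x ∧ ⋀ (y ∷ xs)

⋀-resp-≋ : ∀ {xs ys} → xs ≋ ys → ⋀ xs ≅ ⋀ ys
⋀-resp-≋ []                = refl
⋀-resp-≋ (e ∷ [])          = e
⋀-resp-≋ (e ∷ es@(_ ∷ _))  = cong∧ e (⋀-resp-≋ es)

⋀-resp-↭ : ∀ {xs ys} → xs ↭ ys → ⋀ xs ≅ ⋀ ys
⋀-resp-↭ (Perm.refl es) = ⋀-resp-≋ es
⋀-resp-↭ (Perm.prep {[]} {[]} e _) = e
⋀-resp-↭ (Perm.prep {_ ∷ _} {_ ∷ _} e p) = cong∧ e (⋀-resp-↭ p)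
⋀-resp-↭ (Perm.prep {[]} {_ ∷ _} _ p) with () ← xs↭ys⇒|xs|≡|ys| p
⋀-resp-↭ (Perm.prep {_ ∷ _} {[]} _ p) with () ← xs↭ys⇒|xs|≡|ys| p
⋀-resp-↭ (Perm.swap {[]} {[]} e₁ e₂ _) = trans comm (cong∧ e₂ e₁)
⋀-resp-↭ (Perm.swap {_ ∷ _} {_ ∷ _} e₁ e₂ p) =
  trans asso (trans (cong∧ comm refl) (trans (sym asso) (cong∧ e₂ (cong∧ e₁ (⋀-resp-↭ p)))))
⋀-resp-↭ (Perm.swap {[]} {_ ∷ _} _ _ p) with () ← xs↭ys⇒|xs|≡|ys| p
⋀-resp-↭ (Perm.swap {_ ∷ _} {[]} _ _ p) with () ← xs↭ys⇒|xs|≡|ys| p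
⋀-resp-↭ (Perm.trans p q) = trans (⋀-resp-↭ p) (⋀-resp-↭ q)

⋀-++ : ∀ {xs ys} → NonEmpty xs → NonEmpty ys → ⋀ (xs ++ ys) ≅ (⋀ xs ∧ ⋀ ys)
⋀-++ {_ ∷ []}     nonEmpty nonEmpty = refl
⋀-++ {_ ∷ y ∷ xs} nonEmpty ne       = trans (cong∧ refl (⋀-++ {y ∷ xs} nonEmpty ne)) asso

⋀-map : (f : Ty → Ty) → (∀ {x y} → f (x ∧ y) ≅ (f x ∧ f y)) →
        ∀ {xs} → NonEmpty xs → ⋀ (map f xs) ≅ f (⋀ xs)
⋀-map f f-∧ {_ ∷ []}     nonEmpty = refl
⋀-map f f-∧ {_ ∷ y ∷ xs} nonEmpty = trans (cong∧ refl (⋀-map f f-∧ {y ∷ xs} nonEmpty)) (sym f-∧)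

factors : Ty → List Ty
factors (var n) = var n ∷ []
factors (A ⇒ B) = map (A ⇒_) (factors B)
factors (A ∧ B) = factors A ++ factors B
factors (all A) = map all (factors A)

NonEmpty-factors : ∀ T → NonEmpty (factors T)
NonEmpty-factors (var n) = nonEmpty
NonEmpty-factors (A ⇒ B) = NonEmpty-map⁺ (NonEmpty-factors B)
NonEmpty-factors (A ∧ B) = NonEmpty-++⁺ˡ (NonEmpty-factors A)
NonEmpty-factors (all A) = NonEmpty-map⁺ (NonEmpty-factors A)

⋀-factors : ∀ T → T ≅ ⋀ (factors T)
⋀-factors (var n) = refl
⋀-factors (A ⇒ B) =
  trans (cong⇒ refl (⋀-factors B)) (sym (⋀-map (A ⇒_) dist (NonEmpty-factors B)))
⋀-factors (A ∧ B) =
  trans (cong∧ (⋀-factors A) (⋀-factors B)) (sym (⋀-++ (NonEmpty-factors A) (NonEmpty-factors B)))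
⋀-factors (all A) =
  trans (cong∀ (⋀-factors A)) (sym (⋀-map all p-dist (NonEmpty-factors A)))

map-cong-↭ : ∀ {f g : Ty → Ty} → (∀ x → f x ≅ g x) → ∀ xs → map f xs ↭ map g xs
map-cong-↭ f≅g []       = ↭-refl
map-cong-↭ f≅g (x ∷ xs) = Perm.prep (f≅g x) (map-cong-↭ f≅g xs)

map-∘-↭ : ∀ {f g h : Ty → Ty} → (∀ x → f x ≅ g (h x)) → ∀ xs → map f xs ↭ map g (map h xs)
map-∘-↭ f≅gh xs = ↭-trans (map-cong-↭ f≅gh xs) (↭-reflexive (map-∘ xs))

factors-resp-≅ : ∀ {S T} → S ≅ T → factors S ↭ factors T
factors-resp-≅ refl        = ↭-refl
factors-resp-≅ (sym p)     = ↭-sym (factors-resp-≅ p)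
factors-resp-≅ (trans p q) = ↭-trans (factors-resp-≅ p) (factors-resp-≅ q)
factors-resp-≅ (cong⇒ {B' = B'} p q) =
  ↭-trans (map⁺ ≅-setoid (cong⇒ refl) (factors-resp-≅ q))
          (map-cong-↭ (λ _ → cong⇒ p refl) (factors B'))
factors-resp-≅ (cong∧ p q) = ++⁺ (factors-resp-≅ p) (factors-resp-≅ q)
factors-resp-≅ (cong∀ p)   = map⁺ ≅-setoid cong∀ (factors-resp-≅ p)
factors-resp-≅ (comm {A} {B})       = ++-comm (factors A) (factors B)
factors-resp-≅ (asso {A} {B} {C})   = ↭-sym (++-assoc (factors A) (factors B) (factors C))
factors-resp-≅ (dist {A} {B} {C})   = ↭-reflexive (map-++ (A ⇒_) (factors B) (factors C))
factors-resp-≅ (curry {C = C})      = map-∘-↭ (λ _ → curry) (factors C)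
factors-resp-≅ (p-comm {A} {B})     =
  ↭-trans (↭-sym (map-∘-↭ (λ _ → refl) (factors B))) (map-∘-↭ (λ _ → p-comm) (factors B))
factors-resp-≅ (p-dist {A} {B})     = ↭-reflexive (map-++ all (factors A) (factors B))

factors-↭⇒≅-⋀ : ∀ {T xs} → factors T ↭ xs → T ≅ ⋀ xs
factors-↭⇒≅-⋀ {T} p = trans (⋀-factors T) (⋀-resp-↭ p)

mainTheorem7 : (A B C₁ C₂ : Ty) → (A ⇒ B) ≅ (C₁ ∧ C₂) →
    Σ Ty (λ B₁ → Σ Ty (λ B₂ → (C₁ ≅ (A ⇒ B₁)) × ((C₂ ≅ (A ⇒ B₂)) × (B ≅ (B₁ ∧ B₂)))))
mainTheorem7 A B C₁ C₂ iso
  with M₁ , M₂ , B↭ , C₁↭ , C₂↭ ← map-↭-++⁻ ≅-setoid (A ⇒_) (factors B) (factors-resp-≅ iso) =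
  ⋀ M₁ , ⋀ M₂ ,
  trans (factors-↭⇒≅-⋀ C₁↭) (⋀-map (A ⇒_) dist M₁-nonEmpty) ,
  trans (factors-↭⇒≅-⋀ C₂↭) (⋀-map (A ⇒_) dist M₂-nonEmpty) ,
  trans (factors-↭⇒≅-⋀ B↭) (⋀-++ M₁-nonEmpty M₂-nonEmpty)
  where
  M₁-nonEmpty : NonEmpty M₁
  M₁-nonEmpty = NonEmpty-map⁻ M₁ (NonEmpty-resp-↭ ≅-setoid C₁↭ (NonEmpty-factors C₁))
  M₂-nonEmpty : NonEmpty M₂
  M₂-nonEmpty = NonEmpty-map⁻ M₂ (NonEmpty-resp-↭ ≅-setoid C₂↭ (NonEmpty-factors C₂))
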